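{- For any Boolean conjunctive query $Q$ over a distributed schema and any source $s$, two $s$-instances are $(s,Q)$-equivalent if and only if they agree on each invariant shuffle view of $Q$ for $s$.
   Context: A distributed schema has finitely many sources with pairwise disjoint local schemas $\mathcal{S}_s$; an $s$-instance is an instance of $\mathcal{S}_s$; a context for $s$ is an instance of the union of the other local schemas; $(I,C)$ is the combined d-instance. $I_1,I_2$ are $(s,Q)$-equivalent if for every context $C$, $(I_1,C)\models Q$ iff $(I_2,C)\models Q$. $\mathrm{SVars}(s,Q)$: variables of $Q$ in atoms over $\mathcal{S}_s$; $\mathrm{SJVars}(s,Q)$: those also in an atom of another source. $\mathrm{CanV}^s(Q)$: conjunction of atoms of $Q$ over $\mathcal{S}_s$, variables outside $\mathrm{SJVars}(s,Q)$ existentially quantified; $\mathrm{CanCtxt}^s(Q)$: conjunction of atoms of $Q$ not over $\mathcal{S}_s$, variables outside $\mathrm{SJVars}(s,Q)$ existentially quantified; both have free variables $\vec x=\mathrm{SJVars}(s,Q)$. A shuffle is a map $\mu:\mathrm{SJVars}(s,Q)\to\mathrm{SJVars}(s,Q)$, acting on formulas by renaming free variables. A type $\tau(\vec x)$ is a complete equality type on $\vec x$: a conjunction stating, for each pair of variables of $\vec x$, whether they are equal or distinct. A shuffle $\mu$ is invariant relative to $\tau$ if for every binding $\sigma$ of $\vec x$ satisfying $\tau$ and every context $C$, $C,\sigma\models\mathrm{CanCtxt}^s(Q)$ implies $C,\sigma\models\mu(\mathrm{CanCtxt}^s(Q))$. The invariant shuffle view of $Q$ for $s$ and type $\tau$ is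 $V_\tau(\vec x)=\tau(\vec x)\wedge\bigvee_\mu \mu(\mathrm{CanV}^s(Q))(\vec x)$, the disjunction ranging over shuffles invariant relative to $\tau$; it is a (possibly unsafe) disjunction, whose output on an instance is the set of bindings of $\vec x$ satisfying it. -}

module Defs where

open import Data.Nat using (ℕ)
open import Data.Fin using (Fin)
open import Data.Vec using (Vec; map)
open import Data.List using (List)
open import Data.List.Relation.Unary.All using (All)
open import Data.Product using (Σ; ∃; _×_; _,_; proj₁)
open import Data.Bool using (Bool; true)
open import Relation.Binary.PropositionalEquality using (_≡_; _≢_)
open import Relation.Nullary using (¬_)
open import Function.Bundles using (_⇔_)
import Data.List.Membership.Propositional as LM
import Data.Vec.Membership.Propositional as VM

-- A distributed schema: finitely many sources (Fin nSrc), finitely many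
-- relation symbols (Fin nRel) with arities; each relation symbol belongs to
-- exactly one source (so the local schemas are pairwise disjoint).
record DSchema : Set where
  field
    nSrc  : ℕ
    nRel  : ℕ
    arity : Fin nRel → ℕ
    owner : Fin nRel → Fin nSrc

module _ (𝒮 : DSchema) where
  open DSchema 𝒮

  Fact : Set
  Fact = Σ (Fin nRel) (λ R → Vec ℕ (arity R))

  -- a (finite) instance: a finite set of facts, given as a list
  Instance : Set
  Instance = List Fact

  IsSInstance : Fin nSrc → Instance → Set
  IsSInstance s I = All (λ f → owner (proj₁ f) ≡ s) I

  IsContext : Fin nSrc → Instance → Set
  IsContext s C = All (λ f → owner (proj₁ f) ≢ s) C

  Atom : ℕ → Set
  Atom nV = Σ (Fin nRel) (λ R → Vec (Fin nV) (arity R))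

  record BCQ : Set where
    constructor bcq
    field
      nV    : ℕ
      atoms : List (Atom nV)

  open BCQ public

  AtomHolds : {nV : ℕ} → Instance → (Fin nV → ℕ) → Atom nV → Set
  AtomHolds D ν (R , xs) = LM._∈_ (R , map ν xs) D

  Models : Instance → (Q : BCQ) → Set
  Models D Q = ∃ λ (ν : Fin (nV Q) → ℕ) → All (AtomHolds D ν) (atoms Q)

  combine : Instance → Instance → Instance
  combine I C = I Data.List.++ C

  SQEquivalent : Fin nSrc → (Q : BCQ) → Instance → Instance → Set
  SQEquivalent s Q I₁ I₂ =
    (C : Instance) → IsContext s C → Models (combine I₁ C) Q ⇔ Models (combine I₂ C) Q

  OverS : {nV : ℕ} → Fin nSrc → Atom nV → Set
  OverS s (R , _) = owner R ≡ s

  OccursIn : {nV : ℕ} → Fin nV → Atom nV → Set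
  OccursIn x (R , xs) = VM._∈_ x xs

  SVar : Fin nSrc → (Q : BCQ) → Fin (nV Q) → Set
  SVar s Q x = ∃ λ a → LM._∈_ a (atoms Q) × OverS s a × OccursIn x a

  SJVar : Fin nSrc → (Q : BCQ) → Fin (nV Q) → Set
  SJVar s Q x = SVar s Q x × (∃ λ a → LM._∈_ a (atoms Q) × ¬ OverS s a × OccursIn x a)

  -- Bindings of x⃗ = SJVars(s,Q) are represented by total maps
  -- σ : Fin (nV Q) → ℕ, of which only the values on SJVars(s,Q) matter.
  Binding : BCQ → Set
  Binding Q = Fin (nV Q) → ℕ

  CanV : (s : Fin nSrc) (Q : BCQ) → Instance → Binding Q → Set
  CanV s Q I σ = ∃ λ (ν : Fin (nV Q) → ℕ) →
    ((x : Fin (nV Q)) → SJVar s Q x → ν x ≡ σ x) ×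
    All (λ a → OverS s a → AtomHolds I ν a) (atoms Q)

  CanCtxt : (s : Fin nSrc) (Q : BCQ) → Instance → Binding Q → Set
  CanCtxt s Q C σ = ∃ λ (ν : Fin (nV Q) → ℕ) →
    ((x : Fin (nV Q)) → SJVar s Q x → ν x ≡ σ x) ×
    All (λ a → ¬ OverS s a → AtomHolds C ν a) (atoms Q)

  -- a shuffle μ : SJVars(s,Q) → SJVars(s,Q), represented by a map on all
  -- variables that sends SJVars into SJVars (values elsewhere irrelevant)
  IsShuffle : (s : Fin nSrc) (Q : BCQ) → (Fin (nV Q) → Fin (nV Q)) → Set
  IsShuffle s Q μ = (x : Fin (nV Q)) → SJVar s Q x → SJVar s Q (μ x)

  -- renaming free variables by μ: (μ φ)(x⃗) under σ is φ under σ ∘ μ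
  shuffleBinding : (Q : BCQ) → (Fin (nV Q) → Fin (nV Q)) → Binding Q → Binding Q
  shuffleBinding Q μ σ x = σ (μ x)

  -- an equality type on x⃗: for each pair of variables, equal (true) or
  -- distinct (false); entries outside SJVars are irrelevant
  EqType : BCQ → Set
  EqType Q = Fin (nV Q) → Fin (nV Q) → Bool

  SatType : (s : Fin nSrc) (Q : BCQ) → EqType Q → Binding Q → Set
  SatType s Q τ σ = (x y : Fin (nV Q)) → SJVar s Q x → SJVar s Q y →
    (σ x ≡ σ y) ⇔ (τ x y ≡ true)

  Invariant : (s : Fin nSrc) (Q : BCQ) → EqType Q → (Fin (nV Q) → Fin (nV Q)) → Set
  Invariant s Q τ μ = (σ : Binding Q) → SatType s Q τ σ →
    (C : Instance) → IsContext s C →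
    CanCtxt s Q C σ → CanCtxt s Q C (shuffleBinding Q μ σ)

  ShuffleView : (s : Fin nSrc) (Q : BCQ) → EqType Q → Instance → Binding Q → Set
  ShuffleView s Q τ I σ = SatType s Q τ σ ×
    (∃ λ μ → IsShuffle s Q μ × Invariant s Q τ μ × CanV s Q I (shuffleBinding Q μ σ))

  AgreeOnViews : Fin nSrc → (Q : BCQ) → Instance → Instance → Set
  AgreeOnViews s Q I₁ I₂ = (τ : EqType Q) (σ : Binding Q) →
    ShuffleView s Q τ I₁ σ ⇔ ShuffleView s Q τ I₂ σ

module Submission where

-- Views ⇒ equivalence: a model ν of (I₁ , C) splits into CanV on I₁ and
-- CanCtxt on C at the binding ν.  Via the identity shuffle ν is an output of
-- a view on I₁, hence of the same view on I₂ via some invariant shuffle μ;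
-- invariance moves CanCtxt on C to ν ∘ μ, and gluing CanV and CanCtxt at
-- ν ∘ μ gives a model of (I₂ , C).
--
-- Equivalence ⇒ views: for an output σ of a view on I₁ build the canonical
-- context CF (non-s atoms of Q, join variables frozen to σ, other variables
-- to fresh values).  Invariance and gluing give (I₁ , CF) ⊨ Q, so
-- (I₂ , CF) ⊨ Q by some ν, which sends each join variable to σ of a join
-- variable; this is a shuffle, invariant because CF maps homomorphically
-- into every context realising CanCtxt at a binding of the same type.

open import Defs
open import Data.Nat using (ℕ; suc; _+_; _<_; s≤s) renaming (_≟_ to _≟ℕ_)
open import Data.Nat.Properties using (m≤m+n; <-irrefl; ≤-<-trans; +-cancelˡ-≡)
open import Data.Fin using (Fin; toℕ) renaming (_≟_ to _≟F_)
open import Data.Fin.Properties using (any?; toℕ-injective)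
open import Data.Vec using (Vec; []; _∷_; map; toList)
open import Data.Vec.Properties using (map-∘; map-cong)
import Data.Vec.Relation.Unary.Any as VAny
import Data.Vec.Membership.Propositional as VM
open import Data.Vec.Membership.Propositional.Properties using (∈-toList⁺) renaming (∈-map⁺ to ∈-map⁺ᵛ)
open import Data.List using (List; _++_; filter; concatMap; tabulate)
import Data.List as L
open import Data.List.Relation.Unary.All using (All)
import Data.List.Relation.Unary.All as All
import Data.List.Relation.Unary.All.Properties as AllP
import Data.List.Relation.Unary.Any as LAny
import Data.List.Membership.Propositional as LM
open import Data.List.Membership.Propositional.Properties
  using (∈-map⁺; ∈-map⁻; ∈-++⁺ˡ; ∈-++⁺ʳ; ∈-++⁻; ∈-filter⁺; ∈-filter⁻; ∈-concatMap⁺; ∈-tabulate⁺)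
open import Data.List.Extrema.Nat using (max; xs≤max)
open import Data.Product using (∃; _×_; _,_; proj₁; proj₂)
open import Data.Sum using (_⊎_; inj₁; inj₂)
open import Data.Empty using (⊥-elim)
open import Function using (_∘_; id)
open import Function.Bundles using (_⇔_; mk⇔; Equivalence)
open import Relation.Nullary using (¬_; Dec; yes; no; ¬?)
open import Relation.Nullary.Decidable using (⌊_⌋; map′; _×-dec_)
open import Relation.Unary using (Decidable)
open import Relation.Binary.Definitions using (DecidableEquality)
open import Relation.Binary.PropositionalEquality

map-cong-∈ : ∀ {A B : Set} {k} {f g : A → B} (xs : Vec A k) →
  (∀ x → x VM.∈ xs → f x ≡ g x) → map f xs ≡ map g xs
map-cong-∈ [] _ = refl
map-cong-∈ (x ∷ xs) agree =
  cong₂ _∷_ (agree x (VAny.here refl)) (map-cong-∈ xs (λ y y∈ → agree y (VAny.there y∈)))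

∈-map⁻ᵛ : ∀ {A B : Set} {k} (f : A → B) {y} (xs : Vec A k) →
  y VM.∈ map f xs → ∃ λ x → x VM.∈ xs × y ≡ f x
∈-map⁻ᵛ f (x ∷ xs) (VAny.here y≡fx) = x , VAny.here refl , y≡fx
∈-map⁻ᵛ f (x ∷ xs) (VAny.there y∈) =
  let z , z∈ , y≡fz = ∈-map⁻ᵛ f xs y∈ in z , VAny.there z∈ , y≡fz

choiceOn : ∀ {A : Set} {P : A → Set} {R : A → A → Set} → Decidable P →
  (∀ x → P x → ∃ (R x)) → ∃ λ (μ : A → A) → ∀ x → P x → R x (μ x)
choiceOn {A} {P} {R} P? total = μ , μ-correct
  where
  μ : A → A
  μ x with P? x
  ... | yes p = proj₁ (total x p)
  ... | no _  = x

  μ-correct : ∀ x → P x → R x (μ x)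
  μ-correct x p with P? x
  ... | yes p′ = proj₂ (total x p′)
  ... | no ¬p  = ⊥-elim (¬p p)

factorThrough : ∀ {n} {A B : Set} → DecidableEquality A → B →
  (e : Fin n → A) (t : Fin n → B) → (∀ i j → e i ≡ e j → t i ≡ t j) →
  ∃ λ (g : A → B) → ∀ i → g (e i) ≡ t i
factorThrough {n} {A} {B} _≟_ default e t fibreConst = g , g∘e≡t
  where
  g : A → B
  g a with any? (λ i → e i ≟ a)
  ... | yes (i , _) = t i
  ... | no _        = default

  g∘e≡t : ∀ i → g (e i) ≡ t i
  g∘e≡t i with any? (λ j → e j ≟ e i)
  ... | yes (j , ej≡ei) = fibreConst j i ej≡ei
  ... | no none         = ⊥-elim (none (i , refl))

strictBound : (vs : List ℕ) → ∃ λ N → ∀ {v} → v LM.∈ vs → v < N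
strictBound vs = suc (max 0 vs) , λ v∈ → s≤s (All.lookup (xs≤max 0 vs) v∈)

module _ (𝒮 : DSchema) where
  open DSchema 𝒮

  module _ {s : Fin nSrc} {I C : Instance 𝒮} (sI : IsSInstance 𝒮 s I)
           (ctx : IsContext 𝒮 s C) {f : Fact 𝒮} (f∈ : f LM.∈ I ++ C) where

    sFactInInstance : owner (proj₁ f) ≡ s → f LM.∈ I
    sFactInInstance over with ∈-++⁻ I f∈
    ... | inj₁ f∈I = f∈I
    ... | inj₂ f∈C = ⊥-elim (All.lookup ctx f∈C over)

    otherFactInContext : owner (proj₁ f) ≢ s → f LM.∈ C
    otherFactInContext ¬over with ∈-++⁻ I f∈
    ... | inj₁ f∈I = ⊥-elim (¬over (All.lookup sI f∈I))
    ... | inj₂ f∈C = f∈C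

  mapFact : (ℕ → ℕ) → Fact 𝒮 → Fact 𝒮
  mapFact g (R , vs) = R , map g vs

  Hom : (ℕ → ℕ) → Instance 𝒮 → Instance 𝒮 → Set
  Hom g C C′ = ∀ {f} → f LM.∈ C → mapFact g f LM.∈ C′

  values : Instance 𝒮 → List ℕ
  values = concatMap (toList ∘ proj₂)

  value∈values : ∀ {D f v} → f LM.∈ D → v VM.∈ proj₂ f → v LM.∈ values D
  value∈values f∈ v∈ = ∈-concatMap⁺ (toList ∘ proj₂) (LM.lose f∈ (∈-toList⁺ v∈))

  module ForQuery (Q : BCQ 𝒮) (s : Fin nSrc) where

    Var : Set
    Var = Fin (nV Q)

    As : List (Atom 𝒮 (nV Q))
    As = atoms Q

    SJ : Var → Set
    SJ = SJVar 𝒮 s Q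

    Agrees : (Var → ℕ) → Binding 𝒮 Q → Set
    Agrees ν ρ = ∀ x → SJ x → ν x ≡ ρ x

    OverS? : Decidable (OverS 𝒮 {nV Q} s)
    OverS? (R , _) = owner R ≟F s

    occursIn? : {P : Atom 𝒮 (nV Q) → Set} → Decidable P →
      ∀ x → Dec (∃ λ a → a LM.∈ As × P a × OccursIn 𝒮 x a)
    occursIn? P? x =
      map′ LM.find (λ (a , a∈ , p) → LM.lose a∈ p)
        (LAny.any? (λ a → P? a ×-dec VAny.any? (x ≟F_) (proj₂ a)) As)

    SVar? : Decidable (SVar 𝒮 s Q)
    SVar? = occursIn? OverS?

    SJVar? : Decidable SJ
    SJVar? x = SVar? x ×-dec occursIn? (¬? ∘ OverS?) x

    valueOccurs : ∀ {P : Atom 𝒮 (nV Q) → Set} {D ν x a} → a LM.∈ As → P a →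
      OccursIn 𝒮 x a → All (λ b → P b → AtomHolds 𝒮 D ν b) As →
      ∃ λ f → f LM.∈ D × ν x VM.∈ proj₂ f
    valueOccurs {a = R , xs} a∈ p x∈ holds =
      (R , map _ xs) , All.lookup holds a∈ p , ∈-map⁺ᵛ _ x∈

    atomHolds-cong : ∀ {D ν ν′} (a : Atom 𝒮 (nV Q)) →
      (∀ x → OccursIn 𝒮 x a → ν x ≡ ν′ x) → AtomHolds 𝒮 D ν a → AtomHolds 𝒮 D ν′ a
    atomHolds-cong {D} (R , xs) agree =
      subst (λ vs → (R , vs) LM.∈ D) (map-cong-∈ xs agree)

    rebind : ∀ {P : (Var → ℕ) → Set} {ρ ρ′ : Binding 𝒮 Q} →
      Agrees ρ ρ′ → (∃ λ ν → Agrees ν ρ × P ν) → ∃ λ ν → Agrees ν ρ′ × P ν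
    rebind ρ≈ρ′ (ν , ν≈ρ , p) = ν , (λ x sj → trans (ν≈ρ x sj) (ρ≈ρ′ x sj)) , p

    module _ {I C : Instance 𝒮} (sI : IsSInstance 𝒮 s I) (ctx : IsContext 𝒮 s C)
             {ν : Var → ℕ} (holds : All (AtomHolds 𝒮 (I ++ C) ν) As) where

      sAtomsInInstance : All (λ a → OverS 𝒮 s a → AtomHolds 𝒮 I ν a) As
      sAtomsInInstance = All.map (λ h → sFactInInstance sI ctx h) holds

      otherAtomsInContext : All (λ a → ¬ OverS 𝒮 s a → AtomHolds 𝒮 C ν a) As
      otherAtomsInContext = All.map (λ h → otherFactInContext sI ctx h) holds

    -- The glued valuation follows the CanV witness on SVars and the CanCtxt
    -- witness elsewhere; both agree on SVars occurring in non-s atoms, which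
    -- are join variables.
    glue : ∀ {I C ρ} → CanV 𝒮 s Q I ρ → CanCtxt 𝒮 s Q C ρ → Models 𝒮 (I ++ C) Q
    glue {I} {C} (ν₁ , ν₁≈ρ , sHolds) (ν₂ , ν₂≈ρ , cHolds) =
      ν , All.tabulate (λ {a} a∈ → atomHolds a a∈)
      where
      choose : ∀ x → Dec (SVar 𝒮 s Q x) → ℕ
      choose x (yes _) = ν₁ x
      choose x (no _)  = ν₂ x

      ν : Var → ℕ
      ν x = choose x (SVar? x)

      ν≡ν₁ : ∀ x → SVar 𝒮 s Q x → ν x ≡ ν₁ x
      ν≡ν₁ x sv with SVar? x
      ... | yes _  = refl
      ... | no ¬sv = ⊥-elim (¬sv sv)

      ν≡ν₂ : ∀ {x b} → b LM.∈ As → ¬ OverS 𝒮 s b → OccursIn 𝒮 x b → ν x ≡ ν₂ x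
      ν≡ν₂ {x} {b} b∈ ¬over x∈ with SVar? x
      ... | yes sv = let sj = sv , b , b∈ , ¬over , x∈ in trans (ν₁≈ρ x sj) (sym (ν₂≈ρ x sj))
      ... | no _   = refl

      atomHolds : ∀ a → a LM.∈ As → AtomHolds 𝒮 (I ++ C) ν a
      atomHolds a a∈ with OverS? a
      ... | yes over = atomHolds-cong a (λ x x∈ → sym (ν≡ν₁ x (a , a∈ , over , x∈)))
                         (∈-++⁺ˡ (All.lookup sHolds a∈ over))
      ... | no ¬over = atomHolds-cong a (λ x x∈ → sym (ν≡ν₂ a∈ ¬over x∈))
                         (∈-++⁺ʳ I (All.lookup cHolds a∈ ¬over))

    canCtxt-hom : ∀ {C C′ ρ} (g : ℕ → ℕ) → Hom g C C′ →
      CanCtxt 𝒮 s Q C ρ → CanCtxt 𝒮 s Q C′ (g ∘ ρ)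
    canCtxt-hom {C} {C′} g hom (ν , ν≈ρ , holds) =
      g ∘ ν , (λ x sj → cong g (ν≈ρ x sj)) , All.map (λ {a} h ¬over → image a (h ¬over)) holds
      where
      image : ∀ a → AtomHolds 𝒮 C ν a → AtomHolds 𝒮 C′ (g ∘ ν) a
      image (R , xs) h = subst (λ vs → (R , vs) LM.∈ C′) (sym (map-∘ g ν xs)) (hom h)

    typeOf : Binding 𝒮 Q → EqType 𝒮 Q
    typeOf σ x y = ⌊ σ x ≟ℕ σ y ⌋

    typeOf-sat : ∀ σ → SatType 𝒮 s Q (typeOf σ) σ
    typeOf-sat σ x y _ _ with σ x ≟ℕ σ y
    ... | yes eq  = mk⇔ (λ _ → refl) (λ _ → eq)
    ... | no ¬eq  = mk⇔ (λ eq → ⊥-elim (¬eq eq)) (λ ())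

    sameType : ∀ {τ σ σ′} → SatType 𝒮 s Q τ σ → SatType 𝒮 s Q τ σ′ →
      ∀ {x y} → SJ x → SJ y → σ x ≡ σ y → σ′ x ≡ σ′ y
    sameType sat sat′ {x} {y} sjx sjy eq =
      Equivalence.from (sat′ x y sjx sjy) (Equivalence.to (sat x y sjx sjy) eq)

    id-invariant : ∀ τ → Invariant 𝒮 s Q τ id
    id-invariant τ _ _ _ _ canC = canC

    -- Views ⇒ equivalence, one direction for a fixed context C: the model ν
    -- is an output of a view on I₁ via the identity shuffle.
    viewsTransferModels : ∀ {I₁ I₂ C} → IsSInstance 𝒮 s I₁ → IsContext 𝒮 s C →
      (∀ τ σ → ShuffleView 𝒮 s Q τ I₁ σ → ShuffleView 𝒮 s Q τ I₂ σ) →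
      Models 𝒮 (I₁ ++ C) Q → Models 𝒮 (I₂ ++ C) Q
    viewsTransferModels {C = C} sI₁ ctx views (ν , holds)
      with views (typeOf ν) ν (typeOf-sat ν , id , (λ _ sj → sj) , id-invariant (typeOf ν) ,
                               (ν , (λ _ _ → refl) , sAtomsInInstance sI₁ ctx holds))
    ... | _ , _ , _ , invariant , canV₂ =
      glue canV₂ (invariant ν (typeOf-sat ν) C ctx (ν , (λ _ _ → refl) , otherAtomsInContext sI₁ ctx holds))

    -- The canonical context for an s-instance I and a binding σ: the non-s
    -- atoms of Q with every join variable x frozen to σ x and every other
    -- variable to its own fresh value, i.e. one exceeding all values of I and σ.
    module CanonicalContext (I : Instance 𝒮) (σ : Binding 𝒮 Q) where

      N : ℕ
      N = proj₁ (strictBound (values I ++ tabulate σ))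

      valueOfI<N : ∀ {f v} → f LM.∈ I → v VM.∈ proj₂ f → v < N
      valueOfI<N f∈ v∈ = proj₂ (strictBound (values I ++ tabulate σ)) (∈-++⁺ˡ (value∈values f∈ v∈))

      σ<N : ∀ y → σ y < N
      σ<N y = proj₂ (strictBound (values I ++ tabulate σ)) (∈-++⁺ʳ (values I) (∈-tabulate⁺ y))

      fresh : Var → ℕ
      fresh z = N + toℕ z

      fresh≮N : ∀ z → ¬ fresh z < N
      fresh≮N z lt = <-irrefl refl (≤-<-trans (m≤m+n N (toℕ z)) lt)

      frozen : Var → ℕ
      frozen x with SJVar? x
      ... | yes _ = σ x
      ... | no _  = fresh x

      frozen-cases : ∀ x → (SJ x × frozen x ≡ σ x) ⊎ (¬ SJ x × frozen x ≡ fresh x)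
      frozen-cases x with SJVar? x
      ... | yes sj = inj₁ (sj , refl)
      ... | no ¬sj = inj₂ (¬sj , refl)

      frozen-sj : ∀ x → SJ x → frozen x ≡ σ x
      frozen-sj x sj with frozen-cases x
      ... | inj₁ (_ , eq)   = eq
      ... | inj₂ (¬sj , _) = ⊥-elim (¬sj sj)

      frozen-small : ∀ x → frozen x < N → SJ x
      frozen-small x lt with frozen-cases x
      ... | inj₁ (sj , _)  = sj
      ... | inj₂ (_ , eq) = ⊥-elim (fresh≮N x (subst (_< N) eq lt))

      frozen-collision : ∀ x y → frozen x ≡ frozen y → x ≡ y ⊎ (SJ x × SJ y × σ x ≡ σ y)
      frozen-collision x y eq with frozen-cases x | frozen-cases y
      ... | inj₁ (sjx , ex) | inj₁ (sjy , ey) = inj₂ (sjx , sjy , trans (sym ex) (trans eq ey))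
      ... | inj₁ (_ , ex) | inj₂ (_ , ey) =
        ⊥-elim (fresh≮N y (subst (_< N) (trans (sym ex) (trans eq ey)) (σ<N x)))
      ... | inj₂ (_ , ex) | inj₁ (_ , ey) =
        ⊥-elim (fresh≮N x (subst (_< N) (trans (sym ey) (trans (sym eq) ex)) (σ<N y)))
      ... | inj₂ (_ , ex) | inj₂ (_ , ey) =
        inj₁ (toℕ-injective (+-cancelˡ-≡ N _ _ (trans (sym ex) (trans eq ey))))

      frozenAtom : Atom 𝒮 (nV Q) → Fact 𝒮
      frozenAtom (R , xs) = R , map frozen xs

      CF : Instance 𝒮
      CF = L.map frozenAtom (filter (¬? ∘ OverS?) As)

      ctxCF : IsContext 𝒮 s CF
      ctxCF = AllP.map⁺ (AllP.all-filter (¬? ∘ OverS?) As)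

      canCtxtCF : CanCtxt 𝒮 s Q CF σ
      canCtxtCF = frozen , frozen-sj ,
        All.tabulate (λ a∈ ¬over → ∈-map⁺ frozenAtom (∈-filter⁺ (¬? ∘ OverS?) a∈ ¬over))

      CF-small : ∀ {f v} → f LM.∈ CF → v VM.∈ proj₂ f → v < N → ∃ λ y → SJ y × σ y ≡ v
      CF-small f∈ v∈ v<N with ∈-map⁻ frozenAtom f∈
      ... | (R , xs) , _ , refl with ∈-map⁻ᵛ frozen xs v∈
      ... | z , _ , refl = z , frozen-small z v<N , sym (frozen-sj z (frozen-small z v<N))

      universal : ∀ {τ σ′ C′} → SatType 𝒮 s Q τ σ → SatType 𝒮 s Q τ σ′ →
        CanCtxt 𝒮 s Q C′ σ′ → ∃ λ g → Hom g CF C′ × (∀ y → SJ y → g (σ y) ≡ σ′ y)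
      universal {σ′ = σ′} {C′} sat sat′ (ν₀ , ν₀≈σ′ , holds) = g , hom , g∘σ
        where
        respects : ∀ x y → frozen x ≡ frozen y → ν₀ x ≡ ν₀ y
        respects x y eq with frozen-collision x y eq
        ... | inj₁ refl = refl
        ... | inj₂ (sjx , sjy , σx≡σy) =
          trans (ν₀≈σ′ x sjx) (trans (sameType sat sat′ sjx sjy σx≡σy) (sym (ν₀≈σ′ y sjy)))

        g : ℕ → ℕ
        g = proj₁ (factorThrough _≟ℕ_ 0 frozen ν₀ respects)

        g∘frozen : ∀ x → g (frozen x) ≡ ν₀ x
        g∘frozen = proj₂ (factorThrough _≟ℕ_ 0 frozen ν₀ respects)

        hom : Hom g CF C′
        hom f∈ with ∈-map⁻ frozenAtom f∈
        ... | (R , xs) , a∈f , refl with ∈-filter⁻ (¬? ∘ OverS?) a∈f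
        ... | a∈ , ¬over = subst (λ vs → (R , vs) LM.∈ C′) image (All.lookup holds a∈ ¬over)
          where
          open ≡-Reasoning
          image : map ν₀ xs ≡ map g (map frozen xs)
          image = begin
            map ν₀ xs             ≡⟨ map-cong (sym ∘ g∘frozen) xs ⟩
            map (g ∘ frozen) xs   ≡⟨ map-∘ g frozen xs ⟩
            map g (map frozen xs) ∎

        g∘σ : ∀ y → SJ y → g (σ y) ≡ σ′ y
        g∘σ y sj = trans (cong g (sym (frozen-sj y sj))) (trans (g∘frozen y) (ν₀≈σ′ y sj))

      -- If (I , CF) ⊨ Q then σ is an output on I of the view for σ's type:
      -- the model sends each join variable to σ of a join variable, which
      -- defines the shuffle, and universality of CF makes it invariant.
      viewFromModel : ∀ {τ} → IsSInstance 𝒮 s I → SatType 𝒮 s Q τ σ →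
        Models 𝒮 (I ++ CF) Q → ShuffleView 𝒮 s Q τ I σ
      viewFromModel {τ} sI sat (ν , holds) =
        sat , μ , (λ x sj → proj₁ (μ-correct x sj)) , invariant ,
        (ν , (λ x sj → sym (proj₂ (μ-correct x sj))) , sHolds)
        where
        sHolds = sAtomsInInstance sI ctxCF holds
        cHolds = otherAtomsInContext sI ctxCF holds

        joinValue : ∀ x → SJ x → ∃ λ y → SJ y × σ y ≡ ν x
        joinValue x ((a , a∈ , over , x∈a) , (b , b∈ , ¬over , x∈b)) =
          let f , f∈I , v∈f = valueOccurs a∈ over x∈a sHolds
              f′ , f′∈CF , v∈f′ = valueOccurs b∈ ¬over x∈b cHolds
          in CF-small f′∈CF v∈f′ (valueOfI<N f∈I v∈f)

        μ : Var → Var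
        μ = proj₁ (choiceOn SJVar? joinValue)

        μ-correct : ∀ x → SJ x → SJ (μ x) × σ (μ x) ≡ ν x
        μ-correct = proj₂ (choiceOn SJVar? joinValue)

        invariant : Invariant 𝒮 s Q τ μ
        invariant σ′ sat′ C′ _ canC′ =
          let g , hom , g∘σ = universal sat sat′ canC′
              g∘ν≈σ′∘μ x sj = trans (cong g (sym (proj₂ (μ-correct x sj)))) (g∘σ (μ x) (proj₁ (μ-correct x sj)))
          in rebind g∘ν≈σ′∘μ (canCtxt-hom g hom (ν , (λ _ _ → refl) , cHolds))

    -- Equivalence ⇒ views, one direction: an output σ of a view on I₁ makes
    -- (I₁ , CF) a model by invariance and gluing, hence (I₂ , CF) as well.
    modelsTransferViews : ∀ {I₁ I₂} → IsSInstance 𝒮 s I₂ →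
      (∀ C → IsContext 𝒮 s C → Models 𝒮 (I₁ ++ C) Q → Models 𝒮 (I₂ ++ C) Q) →
      ∀ τ σ → ShuffleView 𝒮 s Q τ I₁ σ → ShuffleView 𝒮 s Q τ I₂ σ
    modelsTransferViews {I₂ = I₂} sI₂ transfer τ σ (sat , _ , _ , invariant , canV₁) =
      viewFromModel sI₂ sat (transfer CF ctxCF (glue canV₁ (invariant σ sat CF ctxCF canCtxtCF)))
      where open CanonicalContext I₂ σ

mainTheorem6 : (𝒮 : DSchema) (Q : BCQ 𝒮) (s : Fin (DSchema.nSrc 𝒮))
    (I₁ I₂ : Instance 𝒮) → IsSInstance 𝒮 s I₁ → IsSInstance 𝒮 s I₂ →
    SQEquivalent 𝒮 s Q I₁ I₂ ⇔ AgreeOnViews 𝒮 s Q I₁ I₂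
mainTheorem6 𝒮 Q s I₁ I₂ sI₁ sI₂ = mk⇔ equivalence⇒views views⇒equivalence
  where
  open ForQuery 𝒮 Q s
  open Equivalence

  equivalence⇒views : SQEquivalent 𝒮 s Q I₁ I₂ → AgreeOnViews 𝒮 s Q I₁ I₂
  equivalence⇒views equiv τ σ =
    mk⇔ (modelsTransferViews sI₂ (λ C ctx → to (equiv C ctx)) τ σ)
        (modelsTransferViews sI₁ (λ C ctx → from (equiv C ctx)) τ σ)

  views⇒equivalence : AgreeOnViews 𝒮 s Q I₁ I₂ → SQEquivalent 𝒮 s Q I₁ I₂
  views⇒equivalence agree C ctx =
    mk⇔ (viewsTransferModels sI₁ ctx (λ τ σ → to (agree τ σ)))
        (viewsTransferModels sI₂ ctx (λ τ σ → from (agree τ σ)))
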